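{- Let $n=p_1p_2p_3$ ($p_i$ distinct primes), $\gcd(n,6)=1$, $n>1000$, $G$ cyclic of order $n$, $\mathrm{ord}(g)=n$. Let $a,b,c$ be integers with $1+c=a+b$ and $1<c<\frac n2<n-b\le n-a<n-1$, such that $S=(g)\cdot(cg)\cdot((n-b)g)\cdot((n-a)g)$ is a reduced minimal zero-sum sequence and one of (A2), (A3), (A4) below holds. Let $k_1$ be as defined below. If $\lceil\frac nc\rceil=\lceil\frac nb\rceil$, then $k_1\le\frac ba$.
   Context: Minimal zero-sum sequence: a finite unordered sequence of elements of $G$ whose terms sum to $0$ and no proper nonempty subsequence of which sums to $0$. $S$ is reduced if for every prime $p\mid n$ the sequence $(pg)\cdot(pcg)\cdot(p(n-b)g)\cdot(p(n-a)g)$ is not minimal zero-sum. Conditions (for a suitable labeling of the primes): (A2) $\{\gcd(c,n),\gcd(b,n),\gcd(a,n)\}=\{p_1,p_2,p_1p_2\}$; (A3) $\gcd(c+1,n)=p_1p_2$, $\gcd(b-1,n)=p_1p_3$, $\gcd(a-1,n)=p_2p_3$; (A4) $\gcd(c,n)=p_1p_2$, $\gcd(b,n)=p_1p_3$, $\gcd(a,n)=p_2p_3$. $k_1$ is the largest positive integer such that $\lceil\frac{(k_1-1)n}{c}\rceil=\lceil\frac{(k_1-1)n}{b}\rceil$ and there is an integer $m$ with $\frac{k_1n}{c}\le m<\frac{k_1n}{b}$. -}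

module Defs where

open import Data.Nat using (ℕ; zero; suc; _+_; _*_; _∸_; _≤_; _<_)
open import Data.Nat.DivMod using (_/_)
open import Data.Nat.Divisibility using (_∣_)
open import Data.Nat.GCD using (gcd)
open import Data.Nat.Primality using (Prime)
open import Data.List using (List; []; _∷_; length; map)
open import Data.Nat.ListAction using (sum)
open import Relation.Binary.PropositionalEquality using (_≡_)
open import Data.List.Membership.Propositional using (_∈_)
open import Data.List.Relation.Binary.Sublist.Propositional using (_⊆_)
open import Data.List.Relation.Binary.Permutation.Propositional using (_↭_)
open import Data.Product using (_×_; ∃; ∃-syntax)
open import Data.Sum using (_⊎_)
open import Relation.Nullary using (¬_)

-- The cyclic group G of order n with generator g is identified with ℤ/nℤ
-- via k·g ↦ k.  A sequence of elements of G of the form (k₁g)⋯(k_rg) is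
-- represented by the list of coefficients k₁ ∷ … ∷ k_r ∷ [].
ZeroSum : ℕ → List ℕ → Set
ZeroSum n S = n ∣ sum S

MinimalZeroSum : ℕ → List ℕ → Set
MinimalZeroSum n S =
  ZeroSum n S ×
  (∀ (T : List ℕ) → T ⊆ S → 0 < length T → length T < length S → ¬ ZeroSum n T)

seqS : ℕ → ℕ → ℕ → ℕ → List ℕ
seqS n a b c = 1 ∷ c ∷ (n ∸ b) ∷ (n ∸ a) ∷ []

Reduced : ℕ → ℕ → ℕ → ℕ → Set
Reduced n a b c =
  ∀ (p : ℕ) → Prime p → p ∣ n → ¬ MinimalZeroSum n (map (p *_) (seqS n a b c))

-- Ceiling of x / y for naturals (y > 0 in all uses).
ceilDiv : ℕ → ℕ → ℕ
ceilDiv x zero = 0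
ceilDiv x (suc y) = (x + y) / suc y

SameSet : List ℕ → List ℕ → Set
SameSet xs ys = (∀ x → x ∈ xs → x ∈ ys) × (∀ y → y ∈ ys → y ∈ xs)

A2 : ℕ → ℕ → ℕ → ℕ → ℕ → ℕ → ℕ → Set
A2 n a b c q₁ q₂ q₃ =
  SameSet (gcd c n ∷ gcd b n ∷ gcd a n ∷ []) (q₁ ∷ q₂ ∷ q₁ * q₂ ∷ [])

A3 : ℕ → ℕ → ℕ → ℕ → ℕ → ℕ → ℕ → Set
A3 n a b c q₁ q₂ q₃ =
  (gcd (c + 1) n ≡ q₁ * q₂) × (gcd (b ∸ 1) n ≡ q₁ * q₃) × (gcd (a ∸ 1) n ≡ q₂ * q₃)

A4 : ℕ → ℕ → ℕ → ℕ → ℕ → ℕ → ℕ → Set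
A4 n a b c q₁ q₂ q₃ =
  (gcd c n ≡ q₁ * q₂) × (gcd b n ≡ q₁ * q₃) × (gcd a n ≡ q₂ * q₃)

SomeA : ℕ → ℕ → ℕ → ℕ → ℕ → ℕ → ℕ → Set
SomeA p₁ p₂ p₃ n a b c =
  ∃[ q₁ ] ∃[ q₂ ] ∃[ q₃ ]
    ((p₁ ∷ p₂ ∷ p₃ ∷ []) ↭ (q₁ ∷ q₂ ∷ q₃ ∷ [])) ×
    (A2 n a b c q₁ q₂ q₃ ⊎ A3 n a b c q₁ q₂ q₃ ⊎ A4 n a b c q₁ q₂ q₃)

-- The property defining k₁ (k positive):
-- ⌈(k-1)n/c⌉ = ⌈(k-1)n/b⌉ and ∃ integer m with kn/c ≤ m < kn/b.
-- (m is necessarily positive here, since kn/c > 0.)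
K1Prop : ℕ → ℕ → ℕ → ℕ → Set
K1Prop n b c k =
  0 < k ×
  (ceilDiv ((k ∸ 1) * n) c ≡ ceilDiv ((k ∸ 1) * n) b) ×
  (∃[ m ] (k * n ≤ m * c × m * b < k * n))

IsK1 : ℕ → ℕ → ℕ → ℕ → Set
IsK1 n b c k₁ = K1Prop n b c k₁ × (∀ k → K1Prop n b c k → k ≤ k₁)

module Submission where

-- Write a = 2 + α, so that c = a + b - 1 = b + d with d = 1 + α.  The proof
-- only uses, besides the size conditions 2c < n, 2 ≤ a ≤ b and 3 ∤ n, the
-- two ceiling equalities ⌈n/c⌉ = ⌈n/b⌉ and ⌈(k₁-1)n/c⌉ = ⌈(k₁-1)n/b⌉; in
-- fact it shows k·a ≤ b for every k > 0 with ⌈(k-1)n/c⌉ = ⌈(k-1)n/b⌉.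
--
-- The key estimate (ceilDiv-gap): if ⌈X/(b+d)⌉ = ⌈X/b⌉ = t then
-- t(b+d) ≤ X + (b+d-1) and X ≤ tb, hence X·d ≤ (b+d-1)·b.
-- Suppose k = j + 2 and b < k·a.  Applying the estimate to X = (j+1)n and
-- using n > 2c gives 2(j+1)d < b (twice-multiple-below), so b lies strictly
-- between 2(j+1)d and (j+2)(d+1).  Comparing these bounds forces j = 0
-- (only-first-multiple); then b = 2d + 1, c = 3d + 1, and the estimate for
-- X = n together with n > 2c pins n down to 3b (forced-multiple-of-three),
-- contradicting 3 ∤ n.

open import Defs
open import Data.Nat using (ℕ; zero; suc; _+_; _*_; _∸_; _≤_; _<_; z≤n; s≤s; _≤?_)
open import Data.Nat.Properties
open import Data.Nat.DivMod using (_%_; m/n*n≤m; m%n<n; m≡m%n+[m/n]*n)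
open import Data.Nat.Divisibility using (_∣_; divides; ∣1⇒≡1)
open import Data.Nat.GCD using (gcd; gcd-greatest)
open import Data.Nat.Primality using (Prime)
open import Data.Product using (_,_)
open import Data.Empty using (⊥; ⊥-elim)
open import Relation.Nullary using (yes; no; ¬_)
open import Relation.Binary.PropositionalEquality
  using (_≡_; _≢_; refl; sym; trans; cong; subst)
open import Data.Nat.Tactic.RingSolver using (solve-∀)

ceilDiv-mul-≤ : ∀ X c₀ → ceilDiv X (suc c₀) * suc c₀ ≤ X + c₀
ceilDiv-mul-≤ X c₀ = m/n*n≤m (X + c₀) (suc c₀)

ceilDiv-mul-≥ : ∀ X b → 0 < b → X ≤ ceilDiv X b * b
ceilDiv-mul-≥ X (suc b₀) _ = +-cancelʳ-≤ b₀ X (t * suc b₀) (begin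
    X + b₀                         ≡⟨ m≡m%n+[m/n]*n (X + b₀) (suc b₀) ⟩
    (X + b₀) % suc b₀ + t * suc b₀ ≤⟨ +-monoˡ-≤ (t * suc b₀) (≤-pred (m%n<n (X + b₀) (suc b₀))) ⟩
    b₀ + t * suc b₀                ≡⟨ +-comm b₀ (t * suc b₀) ⟩
    t * suc b₀ + b₀                ∎)
  where
  open ≤-Reasoning
  t : ℕ
  t = ceilDiv X (suc b₀)

-- Key estimate: equal ceilings ⌈X/(b+d)⌉ = ⌈X/b⌉ force X·d ≤ (b+d-1)·b
-- (stated with d = 1 + δ, so that b + d - 1 = b + δ).
ceilDiv-gap : ∀ X b δ → 0 < b → ceilDiv X (b + suc δ) ≡ ceilDiv X b →
  X * suc δ ≤ (b + δ) * b
ceilDiv-gap X b δ b>0 same = +-cancelˡ-≤ (X * b) (X * suc δ) ((b + δ) * b) (begin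
    X * b + X * suc δ   ≡⟨ sym (*-distribˡ-+ X b (suc δ)) ⟩
    X * c               ≤⟨ *-monoˡ-≤ c (ceilDiv-mul-≥ X b b>0) ⟩
    t * b * c           ≡⟨ swap t b c ⟩
    t * c * b           ≤⟨ *-monoˡ-≤ b tc≤ ⟩
    (X + (b + δ)) * b   ≡⟨ *-distribʳ-+ b X (b + δ) ⟩
    X * b + (b + δ) * b ∎)
  where
  open ≤-Reasoning
  c : ℕ
  c = b + suc δ
  t : ℕ
  t = ceilDiv X b
  swap : ∀ x y z → x * y * z ≡ x * z * y
  swap = solve-∀
  tc≤ : t * c ≤ X + (b + δ)
  tc≤ = subst (λ s → s * c ≤ X + (b + δ)) same
          (subst (λ c′ → ceilDiv X c′ * c′ ≤ X + (b + δ)) (sym (+-suc b δ))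
                 (ceilDiv-mul-≤ X (b + δ)))

twice-multiple-below : ∀ n b j δ → 2 * (b + suc δ) < n →
  suc j * n * suc δ ≤ (b + δ) * b → 2 * (suc j * suc δ) < b
twice-multiple-below n b j δ big gap = *-cancelʳ-< c (2 * s) b (begin-strict
    2 * s * c         ≡⟨ regroup₁ s c ⟩
    s * (2 * c)       <⟨ *-monoʳ-< s big ⟩
    s * n             ≡⟨ regroup₂ (suc j) n (suc δ) ⟩
    suc j * n * suc δ ≤⟨ gap ⟩
    (b + δ) * b       ≤⟨ *-monoˡ-≤ b (+-monoʳ-≤ b (n≤1+n δ)) ⟩
    c * b             ≡⟨ *-comm c b ⟩
    b * c             ∎)
  where
  open ≤-Reasoning
  c : ℕ
  c = b + suc δ
  s : ℕ
  s = suc j * suc δ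
  regroup₁ : ∀ x y → 2 * x * y ≡ x * (2 * y)
  regroup₁ = solve-∀
  regroup₂ : ∀ x y z → x * z * y ≡ x * y * z
  regroup₂ = solve-∀

odd-between : ∀ m b → 2 * m < b → b < 2 + 2 * m → b ≡ 1 + 2 * m
odd-between m b lo hi = ≤-antisym (≤-pred hi) lo

only-first-multiple : ∀ j α b n → 2 * (suc j * suc α) < b → b < suc (suc j) * (2 + α) →
  2 * (b + suc α) < n → suc j * n * suc α ≤ (b + α) * b → j ≡ 0
only-first-multiple zero α b n _ _ _ _ = refl
only-first-multiple (suc j) (suc α) b n lo hi _ _ =
  ⊥-elim (m+1+n≰m P (subst (_≤ P) (interval-too-short j α) (≤-trans (s≤s lo) hi)))
  where
  P : ℕ
  P = (3 + j) * (3 + α)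
  -- For k, d ≥ 2 no integer lies strictly between 2kd and (k+1)(d+1).
  interval-too-short : ∀ j α → 2 + 2 * ((2 + j) * (2 + α)) ≡ (3 + j) * (3 + α) + suc (j + α + j * α)
  interval-too-short = solve-∀
only-first-multiple (suc j) zero b n lo hi big gap =
  ⊥-elim (m+1+n≰m B² (subst (_≤ B²) (square-too-small j) (subst (λ b → k * suc (2 * (b + 1)) ≤ (b + 0) * b) b≡ kn≤b²)))
  where
  k : ℕ
  k = 2 + j
  m : ℕ
  m = k * 1
  B² : ℕ
  B² = ((1 + 2 * m) + 0) * (1 + 2 * m)
  -- For d = 1, b is squeezed to 2k + 1.
  double-step : ∀ j → (3 + j) * 2 ≡ 2 + 2 * ((2 + j) * 1)
  double-step = solve-∀
  b≡ : b ≡ 1 + 2 * m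
  b≡ = odd-between m b lo (subst (b <_) (double-step j) hi)
  kn≤b² : k * suc (2 * (b + 1)) ≤ (b + 0) * b
  kn≤b² = ≤-trans (*-monoʳ-≤ k big) (subst (_≤ (b + 0) * b) (*-identityʳ (k * n)) gap)
  -- But k·(2(b+1)+1) exceeds b² for b = 2k + 1 and k ≥ 2.
  square-too-small : ∀ j → (2 + j) * suc (2 * ((1 + 2 * ((2 + j) * 1)) + 1))
    ≡ ((1 + 2 * ((2 + j) * 1)) + 0) * (1 + 2 * ((2 + j) * 1)) + suc j
  square-too-small = solve-∀

forced-multiple-of-three : ∀ n b α → b ≡ 1 + 2 * suc α →
  ceilDiv n (b + suc α) ≡ ceilDiv n b → 2 * (b + suc α) < n → n ≡ 3 * b
forced-multiple-of-three n .(1 + 2 * suc α) α refl same big =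
  ≤-antisym upper (subst (_≤ n) (three-halves α) big)
  where
  b : ℕ
  b = 1 + 2 * suc α
  c-1≡ : ∀ α → (1 + 2 * suc α) + α ≡ 3 * suc α
  c-1≡ = solve-∀
  three-halves : ∀ α → suc (2 * ((1 + 2 * suc α) + suc α)) ≡ 3 * (1 + 2 * suc α)
  three-halves = solve-∀
  upper : n ≤ 3 * b
  upper = *-cancelʳ-≤ n (3 * b) (suc α)
    (subst (n * suc α ≤_) (trans (cong (_* b) (c-1≡ α)) (swap 3 (suc α) b))
           (ceilDiv-gap n b α (s≤s z≤n) same))
    where
    swap : ∀ x y z → x * y * z ≡ x * z * y
    swap = solve-∀

no-long-run : ∀ n α b j → ¬ 3 ∣ n → 2 * (b + suc α) < n → 0 < b →
  ceilDiv n (b + suc α) ≡ ceilDiv n b →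
  ceilDiv (suc j * n) (b + suc α) ≡ ceilDiv (suc j * n) b →
  b < suc (suc j) * (2 + α) → ⊥
no-long-run n α b j 3∤n big b>0 same₁ sameₖ hi =
  3∤n (divides b (trans n≡3b (*-comm 3 b)))
  where
  gap : suc j * n * suc α ≤ (b + α) * b
  gap = ceilDiv-gap (suc j * n) b α b>0 sameₖ
  lo : 2 * (suc j * suc α) < b
  lo = twice-multiple-below n b j α big gap
  j≡0 : j ≡ 0
  j≡0 = only-first-multiple j α b n lo hi big gap
  lo₁ : 2 * (1 * suc α) < b
  lo₁ = subst (λ j → 2 * (suc j * suc α) < b) j≡0 lo
  double : ∀ α → 2 * (2 + α) ≡ 2 + 2 * (1 * suc α)
  double = solve-∀
  hi₁ : b < 2 + 2 * (1 * suc α)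
  hi₁ = subst (b <_) (double α) (subst (λ j → b < suc (suc j) * (2 + α)) j≡0 hi)
  b≡ : b ≡ 1 + 2 * suc α
  b≡ = trans (odd-between (1 * suc α) b lo₁ hi₁) (cong (λ x → 1 + 2 * x) (*-identityˡ (suc α)))
  n≡3b : n ≡ 3 * b
  n≡3b = forced-multiple-of-three n b α b≡ same₁ big

multiple-bound : ∀ n α b c k → c ≡ b + suc α → ¬ 3 ∣ n → 2 * c < n → 2 + α ≤ b → 0 < k →
  ceilDiv n c ≡ ceilDiv n b → ceilDiv ((k ∸ 1) * n) c ≡ ceilDiv ((k ∸ 1) * n) b →
  k * (2 + α) ≤ b
multiple-bound n α b .(b + suc α) (suc zero) refl _ _ a≤b _ _ _ =
  subst (_≤ b) (sym (*-identityˡ (2 + α))) a≤b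
multiple-bound n α b .(b + suc α) (suc (suc j)) refl 3∤n big a≤b _ same₁ sameₖ
  with suc (suc j) * (2 + α) ≤? b
... | yes ka≤b = ka≤b
... | no ka≰b = ⊥-elim (no-long-run n α b j 3∤n big (≤-trans (s≤s z≤n) a≤b) same₁ sameₖ (≰⇒> ka≰b))

coprime-to-six⇒3∤ : ∀ n → gcd n 6 ≡ 1 → ¬ 3 ∣ n
coprime-to-six⇒3∤ n g≡1 3∣n with ∣1⇒≡1 (subst (3 ∣_) g≡1 (gcd-greatest 3∣n (divides 2 refl)))
... | ()

two≤a : ∀ n a → n ∸ a < n ∸ 1 → 2 ≤ a
two≤a n a lt = ≮⇒≥ (λ a<2 → <⇒≱ lt (∸-monoʳ-≤ n (≤-pred a<2)))

a≤b : ∀ n a b → n < 2 * (n ∸ b) → n ∸ b ≤ n ∸ a → a ≤ b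
a≤b n a b big le = ≮⇒≥ (λ b<a → <⇒≱ (≤-<-trans (∸-monoʳ-≤ n b<a) (∸-monoʳ-< (n<1+n b) b<n)) le)
  where
  b<n : b < n
  b<n = ≰⇒> (λ n≤b → n≮0 (subst (n <_) (cong (2 *_) (m≤n⇒m∸n≡0 n≤b)) big))

multiple-bound-in-a : ∀ n a b c k → 1 + c ≡ a + b → ¬ 3 ∣ n → 2 * c < n → 2 ≤ a → a ≤ b → 0 < k →
  ceilDiv n c ≡ ceilDiv n b → ceilDiv ((k ∸ 1) * n) c ≡ ceilDiv ((k ∸ 1) * n) b → k * a ≤ b
multiple-bound-in-a n (suc (suc α)) b c k sum 3∤n big _ =
  multiple-bound n α b c k (trans (suc-injective sum) (+-comm (suc α) b)) 3∤n big
multiple-bound-in-a n (suc zero) b c k _ _ _ (s≤s ())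

lemma3p15 : (p₁ p₂ p₃ n a b c k₁ : ℕ) →
    Prime p₁ → Prime p₂ → Prime p₃ →
    p₁ ≢ p₂ → p₁ ≢ p₃ → p₂ ≢ p₃ →
    n ≡ p₁ * p₂ * p₃ → gcd n 6 ≡ 1 → 1000 < n →
    1 + c ≡ a + b →
    1 < c → 2 * c < n → n < 2 * (n ∸ b) → n ∸ b ≤ n ∸ a → n ∸ a < n ∸ 1 →
    MinimalZeroSum n (seqS n a b c) → Reduced n a b c →
    SomeA p₁ p₂ p₃ n a b c →
    IsK1 n b c k₁ →
    ceilDiv n c ≡ ceilDiv n b →
    k₁ * a ≤ b
lemma3p15 p₁ p₂ p₃ n a b c k₁ _ _ _ _ _ _ _ g≡1 _ sum _ 2c<n nb-big nb≤na na<n1 _ _ _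
  ((k₁>0 , sameₖ , _) , _) same₁ =
  multiple-bound-in-a n a b c k₁ sum (coprime-to-six⇒3∤ n g≡1) 2c<n
    (two≤a n a na<n1) (a≤b n a b nb-big nb≤na) k₁>0 same₁ sameₖ
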